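{- Let $G$ be a graph and $t\ge1$ an integer. The total edge set of any triangulated appearance in $G$ of a connected graph of order $t$ shares an edge with the total edge sets of at most $\binom{t+3}{3}$ other triangulated appearances in $G$ of connected graphs of order $t$.
   Context: For a connected graph $H$ whose vertex set is a set of integers, and a graph $G$ whose vertex set is a set of integers, $H$ has a triangulated appearance at $W\subset V(G)$ if (a) the increasing bijection $V(H)\to W$ is an isomorphism from $H$ to the induced subgraph $G[W]$, and (b) there are exactly six edges of $G$ between $W$ and $V(G)\setminus W$, and they are $E_W=\{r_1v_1,v_1r_2,r_2v_2,v_2r_3,r_3v_3,v_3r_1\}$ with $r_1,r_2,r_3\in W$, $v_1,v_2,v_3\in V(G)\setminus W$, and $G[\{v_1,v_2,v_3\}]$ a triangle. Its total edge set is $E(G[W])\cup E_W$. Two triangulated appearances are regarded as different if they are at different sets $W$. -}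

module Defs where

open import Data.Nat using (ℕ)
open import Data.Integer using (ℤ; _<_)
open import Data.List using (List; []; _∷_; map; length)
open import Data.List.Membership.Propositional using (_∈_; _∉_)
open import Data.List.Relation.Unary.All using (All)
open import Data.List.Relation.Unary.AllPairs using (AllPairs)
open import Data.List.Relation.Unary.Linked using (Linked)
open import Data.Product using (Σ; ∃; _×_; _,_; proj₁; proj₂)
open import Data.Sum using (_⊎_)
open import Relation.Nullary using (¬_)
open import Relation.Binary.PropositionalEquality using (_≡_; _≢_)
open import Function.Bundles using (_⇔_)

-- A finite (simple, undirected) graph whose vertex set is a finite set of
-- integers.  The vertex set is represented canonically as a strictly
-- increasing list of integers.
record Graph : Set₁ where
  field
    V      : List ℤ
    sorted : Linked _<_ V
    E      : ℤ → ℤ → Set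
    E-sym  : ∀ {x y} → E x y → E y x
    E-irr  : ∀ {x} → ¬ E x x
    E-dom  : ∀ {x y} → E x y → x ∈ V
open Graph public

data Reach (H : Graph) : ℤ → ℤ → Set where
  here : ∀ {x} → Reach H x x
  step : ∀ {x y z} → E H x y → Reach H y z → Reach H x z

Connected : Graph → Set
Connected H = ∀ {x y} → x ∈ V H → y ∈ V H → Reach H x y

SameEdge : ℤ × ℤ → ℤ × ℤ → Set
SameEdge (a , b) (c , d) = (a ≡ c × b ≡ d) ⊎ (a ≡ d × b ≡ c)

Crossing : Graph → List ℤ → ℤ → ℤ → Set
Crossing G W x y = x ∈ W × y ∈ V G × y ∉ W × E G x y

-- Condition (a): the increasing bijection V(H) → W is an isomorphism
-- H ≅ G[W].  W is a strictly increasing list of vertices of G; the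
-- increasing bijection is given by pairing the i-th element of V(H)
-- with the i-th element of W.
IncIso : Graph → Graph → List ℤ → Set
IncIso G H W =
  Linked _<_ W × All (_∈ V G) W ×
  Σ (List (ℤ × ℤ)) λ P →
    map proj₁ P ≡ V H × map proj₂ P ≡ W ×
    (∀ {p q} → p ∈ P → q ∈ P → E H (proj₁ p) (proj₁ q) ⇔ E G (proj₂ p) (proj₂ q))

-- Condition (b): exactly six edges between W and V(G) \ W, namely
-- r1v1, v1r2, r2v2, v2r3, r3v3, v3r1, with G[{v1,v2,v3}] a triangle.
SixEdges : Graph → List ℤ → Set
SixEdges G W =
  Σ ℤ λ r₁ → Σ ℤ λ r₂ → Σ ℤ λ r₃ → Σ ℤ λ v₁ → Σ ℤ λ v₂ → Σ ℤ λ v₃ →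
    r₁ ∈ W × r₂ ∈ W × r₃ ∈ W ×
    (v₁ ∈ V G × v₁ ∉ W) × (v₂ ∈ V G × v₂ ∉ W) × (v₃ ∈ V G × v₃ ∉ W) ×
    E G v₁ v₂ × E G v₂ v₃ × E G v₃ v₁ ×
    E G r₁ v₁ × E G v₁ r₂ × E G r₂ v₂ × E G v₂ r₃ × E G r₃ v₃ × E G v₃ r₁ ×
    AllPairs (λ e f → ¬ SameEdge e f)
      ((r₁ , v₁) ∷ (v₁ , r₂) ∷ (r₂ , v₂) ∷ (v₂ , r₃) ∷ (r₃ , v₃) ∷ (v₃ , r₁) ∷ []) ×
    (∀ {x y} → Crossing G W x y →
       Data.List.Relation.Unary.Any.Any (SameEdge (x , y))
         ((r₁ , v₁) ∷ (v₁ , r₂) ∷ (r₂ , v₂) ∷ (v₂ , r₃) ∷ (r₃ , v₃) ∷ (v₃ , r₁) ∷ []))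
  where import Data.List.Relation.Unary.Any

TriangulatedAppearance : Graph → Graph → List ℤ → Set
TriangulatedAppearance G H W = IncIso G H W × SixEdges G W

-- W is the site of a triangulated appearance in G of some connected graph
-- of order t.  (Appearances are distinguished by their sets W.)
AppearanceOfOrder : ℕ → Graph → List ℤ → Set₁
AppearanceOfOrder t G W =
  Σ Graph λ H → Connected H × length (V H) ≡ t × TriangulatedAppearance G H W

-- xy (unordered) belongs to the total edge set E(G[W]) ∪ E_W.
-- (Given condition (b), E_W is exactly the set of edges crossing W.)
TotalEdge : Graph → List ℤ → ℤ → ℤ → Set
TotalEdge G W x y = (x ∈ W × y ∈ W × E G x y) ⊎ Crossing G W x y ⊎ Crossing G W y x

ShareEdge : Graph → List ℤ → List ℤ → Set
ShareEdge G W W' = Σ ℤ λ x → Σ ℤ λ y → TotalEdge G W x y × TotalEdge G W' x y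

module Submission where

-- Let W be a triangulated appearance of order t, with outer triangle T
-- (the three vertices outside W adjacent to W).  The proof is a counting
-- argument on the set W ++ T of t + 3 vertices.
--
-- 1. Each appearance is first condensed into a 'Site': a strictly increasing
--    vertex list W of length t, connected inside G, whose outer neighbours
--    form a triangle T, every vertex of T having a neighbour in W.
-- 2. If another site W' shares a total edge with W, then W' contains a vertex
--    of T ('share⇒meets'), and consequently the triangle T' of W' lies inside
--    W ++ T ('meets⇒within').  Both steps follow a walk inside one site until
--    it leaves the other one: the vertex reached lies in the other triangle.
-- 3. Among sites meeting T, the triangle determines the site
--    ('triangle-determines'); here sorted lists of equal length are equal
--    as soon as one is contained in the other.
-- 4. Hence W' ↦ (characteristic mask of T' on W ++ T) is injective into the
--    Boolean lists of length t + 3 with exactly three ones, and there are at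
--    most (t + 3) C 3 pairwise distinct such lists ('masks-bound').

open import Defs
open import Data.Nat using (ℕ; _≤_; _+_)
open import Data.Nat.Combinatorics using (_C_)
open import Data.Integer using (ℤ)
open import Data.List using (List; length)
open import Data.List.Relation.Unary.All using (All)
open import Data.List.Relation.Unary.AllPairs using (AllPairs)
open import Data.Product using (_×_)
open import Relation.Binary.PropositionalEquality using (_≢_)

open import Data.Nat using (zero; suc; z≤n)
open import Data.Nat.Properties using (+-suc; +-mono-≤; ≤-refl; module ≤-Reasoning)
open import Data.Nat.Combinatorics using (nCk+nC[k+1]≡[n+1]C[k+1])
import Data.Integer as ℤ using (_<_)
open import Data.Integer.Properties using (_≟_; <-trans; <⇒≢)
open import Data.Bool using (Bool; true; false)
import Data.Bool.Properties as Bool using (_≟_)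
open import Data.List using ([]; _∷_; map; _++_)
open import Data.List.Properties using (length-map; length-++; ∷-injectiveˡ; ∷-injectiveʳ; ≡-dec)
open import Data.List.Membership.Propositional using (_∈_; _∉_; find)
open import Data.List.Membership.Propositional.Properties using (∈-map⁺; ∈-map⁻; ∈-++⁺ˡ; ∈-++⁺ʳ)
open import Data.List.Membership.DecPropositional _≟_ using (_∈?_)
open import Data.List.Relation.Binary.Subset.Propositional using (_⊆_)
open import Data.List.Relation.Binary.Sublist.Propositional using (minimum; _∷ʳ_; _∷_) renaming (_⊆_ to _⊑_)
open import Data.List.Relation.Binary.Sublist.Propositional.Properties using (to-≋)
open import Data.List.Relation.Binary.Pointwise using (Pointwise-≡⇒≡)
open import Data.List.Relation.Unary.Any using (Any; here; there; tail)
open import Data.List.Relation.Unary.All using ([]; _∷_; lookup; tabulate; all?; reduce)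
open import Data.List.Relation.Unary.All.Properties using (¬All⇒Any¬)
import Data.List.Relation.Unary.AllPairs as AllPairs
open import Data.List.Relation.Unary.AllPairs using ([]; _∷_)
open import Data.List.Relation.Unary.AllPairs.Properties using (++⁺)
open import Data.List.Relation.Unary.Linked using (Linked)
open import Data.List.Relation.Unary.Linked.Properties using (Linked⇒AllPairs)
open import Data.Product using (Σ; _,_; proj₁; proj₂)
open import Data.Sum using (_⊎_; inj₁; inj₂; [_,_])
open import Relation.Nullary using (does; yes; no; contradiction)
open import Relation.Nullary.Decidable using (dec-true)
open import Relation.Binary.PropositionalEquality using (_≡_; refl; sym; trans; cong; cong₂; subst; ≢-sym; module ≡-Reasoning)
open import Function.Bundles using (Equivalence; _⇔_)

private
  variable
    G : Graph
    t : ℕ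
    W W′ W₁ W₂ : List ℤ
    x y z v : ℤ

⊆⇒⊑ : ∀ {A B : List ℤ} → AllPairs ℤ._<_ A → AllPairs ℤ._<_ B → A ⊆ B → A ⊑ B
⊆⇒⊑ {[]} _ _ _ = minimum _
⊆⇒⊑ {a ∷ A} {[]} _ _ A⊆B with () ← A⊆B (here refl)
⊆⇒⊑ {a ∷ A} {b ∷ B} (a<A ∷ A↑) (b<B ∷ B↑) A⊆B with a ≟ b
... | yes refl = refl ∷ ⊆⇒⊑ A↑ B↑ λ x∈A → tail (≢-sym (<⇒≢ (lookup a<A x∈A))) (A⊆B (there x∈A))
... | no a≢b = b ∷ʳ ⊆⇒⊑ (a<A ∷ A↑) B↑ λ x∈aA → tail (≢b x∈aA) (A⊆B x∈aA)
  where
  b<a : b ℤ.< a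
  b<a = lookup b<B (tail a≢b (A⊆B (here refl)))
  ≢b : ∀ {x} → x ∈ a ∷ A → x ≢ b
  ≢b (here refl) = a≢b
  ≢b (there x∈A) = ≢-sym (<⇒≢ (<-trans b<a (lookup a<A x∈A)))

sorted-⊆⇒≡ : ∀ {A B : List ℤ} → Linked ℤ._<_ A → Linked ℤ._<_ B →
             A ⊆ B → length A ≡ length B → A ≡ B
sorted-⊆⇒≡ A↑ B↑ A⊆B same-length =
  Pointwise-≡⇒≡ (to-≋ same-length (⊆⇒⊑ (Linked⇒AllPairs <-trans A↑) (Linked⇒AllPairs <-trans B↑) A⊆B))

data Path (G : Graph) (S : List ℤ) : ℤ → ℤ → Set where
  done : ∀ {x} → Path G S x x
  move : ∀ {x y z} → E G x y → y ∈ S → Path G S y z → Path G S x z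

leave : ∀ {S} → Path G W x y → x ∈ S → y ∉ S →
        Σ ℤ λ w → w ∈ W × Σ ℤ λ u → Crossing G S u w
leave done x∈S y∉S = contradiction x∈S y∉S
leave {G = G} {S = S} (move {y = m} e m∈W p) x∈S y∉S with m ∈? S
... | yes m∈S = leave p m∈S y∉S
... | no m∉S = m , m∈W , _ , x∈S , E-dom G (E-sym G e) , m∉S , e

record Site (G : Graph) (t : ℕ) (W : List ℤ) : Set where
  field
    increasing : Linked ℤ._<_ W
    order      : length W ≡ t
    walk       : ∀ {x y} → x ∈ W → y ∈ W → Path G W x y
    T          : List ℤ
    T-distinct : AllPairs _≢_ T
    T-size     : length T ≡ 3
    T-outside  : ∀ {v} → v ∈ T → v ∉ W
    T-clique   : ∀ {u v} → u ∈ T → v ∈ T → u ≢ v → E G u v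
    boundary   : ∀ {x y} → Crossing G W x y → y ∈ T
    attached   : ∀ {v} → v ∈ T → Σ ℤ λ r → r ∈ W × E G v r

  T-vertex : ∀ {v} → v ∈ T → v ∈ V G
  T-vertex v∈T = E-dom G (proj₂ (proj₂ (attached v∈T)))
open Site

map-distinct⇒injective : ∀ {A B : Set} (f : A → B) {P : List A} {p q : A} →
                         AllPairs _≢_ (map f P) → p ∈ P → q ∈ P → f p ≡ f q → p ≡ q
map-distinct⇒injective f _ (here refl) (here refl) _ = refl
map-distinct⇒injective f (fp≢ ∷ _) (here refl) (there q∈P) eq =
  contradiction eq (lookup fp≢ (∈-map⁺ f q∈P))
map-distinct⇒injective f (fq≢ ∷ _) (there p∈P) (here refl) eq =
  contradiction (sym eq) (lookup fq≢ (∈-map⁺ f p∈P))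
map-distinct⇒injective f (_ ∷ distinct) (there p∈P) (there q∈P) eq =
  map-distinct⇒injective f distinct p∈P q∈P eq

module Transport {G H : Graph} {W : List ℤ} {P : List (ℤ × ℤ)}
  (dom : map proj₁ P ≡ V H) (cod : map proj₂ P ≡ W)
  (iso : ∀ {p q} → p ∈ P → q ∈ P → E H (proj₁ p) (proj₁ q) ⇔ E G (proj₂ p) (proj₂ q)) where

  from-H : x ∈ V H → Σ (ℤ × ℤ) λ p → p ∈ P × x ≡ proj₁ p
  from-H x∈H = ∈-map⁻ proj₁ (subst (_ ∈_) (sym dom) x∈H)

  from-W : x ∈ W → Σ (ℤ × ℤ) λ p → p ∈ P × x ≡ proj₂ p
  from-W x∈W = ∈-map⁻ proj₂ (subst (_ ∈_) (sym cod) x∈W)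

  to-H : ∀ {p} → p ∈ P → proj₁ p ∈ V H
  to-H p∈P = subst (_ ∈_) dom (∈-map⁺ proj₁ p∈P)

  to-W : ∀ {p} → p ∈ P → proj₂ p ∈ W
  to-W p∈P = subst (_ ∈_) cod (∈-map⁺ proj₂ p∈P)

  -- V(H) has no repetitions, so a pair is determined by its first entry.
  pair-injective : ∀ {p q} → p ∈ P → q ∈ P → proj₁ p ≡ proj₁ q → p ≡ q
  pair-injective = map-distinct⇒injective proj₁
    (subst (AllPairs _≢_) (sym dom) (AllPairs.map <⇒≢ (Linked⇒AllPairs <-trans (sorted H))))

  transport : Reach H x y → ∀ {p q} → p ∈ P → q ∈ P → proj₁ p ≡ x → proj₁ q ≡ y →
              Path G W (proj₂ p) (proj₂ q)
  transport here p∈P q∈P refl q≡ with pair-injective p∈P q∈P (sym q≡)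
  ... | refl = done
  transport (step e r) p∈P q∈P refl q≡ with from-H (E-dom H (E-sym H e))
  ... | m , m∈P , refl = move (Equivalence.to (iso p∈P m∈P) e) (to-W m∈P) (transport r m∈P q∈P refl q≡)

  walk-in-W : Connected H → x ∈ W → y ∈ W → Path G W x y
  walk-in-W connected x∈W y∈W with from-W x∈W | from-W y∈W
  ... | p , p∈P , refl | q , q∈P , refl = transport (connected (to-H p∈P) (to-H q∈P)) p∈P q∈P refl refl

  size : length W ≡ length (V H)
  size = trans (cong length (sym cod)) (trans (length-map proj₂ P)
           (trans (sym (length-map proj₁ P)) (cong length dom)))

site : AppearanceOfOrder t G W → Site G t W
site {G = G} {W = W}
     (H , H-connected , H-order , (W↑ , _ , P , dom , cod , iso) ,
      (r₁ , r₂ , r₃ , v₁ , v₂ , v₃ , r₁∈W , r₂∈W , r₃∈W , (_ , v₁∉W) , (_ , v₂∉W) , (_ , v₃∉W) ,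
       e₁₂ , e₂₃ , e₃₁ , f₁ , _ , f₂ , _ , f₃ , _ , _ , six)) = record
  { increasing = W↑
  ; order = trans size H-order
  ; walk = walk-in-W H-connected
  ; T = triangle
  ; T-distinct = (adjacent⇒≢ e₁₂ ∷ ≢-sym (adjacent⇒≢ e₃₁) ∷ []) ∷ (adjacent⇒≢ e₂₃ ∷ []) ∷ [] ∷ []
  ; T-size = refl
  ; T-outside = outside
  ; T-clique = clique
  ; boundary = λ { cr@(_ , _ , y∉W , _) → outer-end y∉W (six cr) }
  ; attached = λ { (here refl) → r₁ , r₁∈W , E-sym G f₁
                 ; (there (here refl)) → r₂ , r₂∈W , E-sym G f₂
                 ; (there (there (here refl))) → r₃ , r₃∈W , E-sym G f₃ }
  }
  where
  open Transport dom cod iso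
  triangle : List ℤ
  triangle = v₁ ∷ v₂ ∷ v₃ ∷ []

  adjacent⇒≢ : ∀ {x y} → E G x y → x ≢ y
  adjacent⇒≢ e refl = E-irr G e

  outside : ∀ {v} → v ∈ triangle → v ∉ W
  outside (here refl) = v₁∉W
  outside (there (here refl)) = v₂∉W
  outside (there (there (here refl))) = v₃∉W

  clique : ∀ {u v} → u ∈ triangle → v ∈ triangle → u ≢ v → E G u v
  clique (here refl) (there (here refl)) _ = e₁₂
  clique (here refl) (there (there (here refl))) _ = E-sym G e₃₁
  clique (there (here refl)) (here refl) _ = E-sym G e₁₂
  clique (there (here refl)) (there (there (here refl))) _ = e₂₃
  clique (there (there (here refl))) (here refl) _ = e₃₁
  clique (there (there (here refl))) (there (here refl)) _ = E-sym G e₂₃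
  clique (here refl) (here refl) u≢v = contradiction refl u≢v
  clique (there (here refl)) (there (here refl)) u≢v = contradiction refl u≢v
  clique (there (there (here refl))) (there (there (here refl))) u≢v = contradiction refl u≢v

  outer-end : y ∉ W →
    Any (SameEdge (x , y)) ((r₁ , v₁) ∷ (v₁ , r₂) ∷ (r₂ , v₂) ∷ (v₂ , r₃) ∷ (r₃ , v₃) ∷ (v₃ , r₁) ∷ []) →
    y ∈ triangle
  outer-end _ (here (inj₁ (_ , refl))) = here refl
  outer-end y∉W (here (inj₂ (_ , refl))) = contradiction r₁∈W y∉W
  outer-end y∉W (there (here (inj₁ (_ , refl)))) = contradiction r₂∈W y∉W
  outer-end _ (there (here (inj₂ (_ , refl)))) = here refl
  outer-end _ (there (there (here (inj₁ (_ , refl))))) = there (here refl)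
  outer-end y∉W (there (there (here (inj₂ (_ , refl))))) = contradiction r₂∈W y∉W
  outer-end y∉W (there (there (there (here (inj₁ (_ , refl)))))) = contradiction r₃∈W y∉W
  outer-end _ (there (there (there (here (inj₂ (_ , refl)))))) = there (here refl)
  outer-end _ (there (there (there (there (here (inj₁ (_ , refl))))))) = there (there (here refl))
  outer-end y∉W (there (there (there (there (here (inj₂ (_ , refl))))))) = contradiction r₃∈W y∉W
  outer-end y∉W (there (there (there (there (there (here (inj₁ (_ , refl)))))))) = contradiction r₁∈W y∉W
  outer-end _ (there (there (there (there (there (here (inj₂ (_ , refl)))))))) = there (there (here refl))

site-⊆⇒≡ : Site G t W₁ → Site G t W₂ → W₁ ⊆ W₂ → W₁ ≡ W₂
site-⊆⇒≡ N₁ N₂ W₁⊆W₂ =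
  sorted-⊆⇒≡ (increasing N₁) (increasing N₂) W₁⊆W₂ (trans (order N₁) (sym (order N₂)))

escape : Site G t W₁ → Site G t W₂ → W₁ ≢ W₂ → Σ ℤ λ a → a ∈ W₁ × a ∉ W₂
escape {W₁ = W₁} {W₂ = W₂} N₁ N₂ W₁≢W₂ with all? (_∈? W₂) W₁
... | yes W₁⊆W₂ = contradiction (site-⊆⇒≡ N₁ N₂ (lookup W₁⊆W₂)) W₁≢W₂
... | no W₁⊈W₂ = find (¬All⇒Any¬ (_∈? W₂) W₁ W₁⊈W₂)

neighbour : ∀ {w} (N : Site G t W) → w ∈ W → E G w y → y ∈ W ⊎ y ∈ T N
neighbour {G = G} {W = W} {y = y} N w∈W e with y ∈? W
... | yes y∈W = inj₁ y∈W
... | no y∉W = inj₂ (boundary N (w∈W , E-dom G (E-sym G e) , y∉W , e))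

-- If two distinct sites of the same order overlap, then the second one
-- contains a vertex of the triangle of the first: walk inside the second site
-- from the common vertex to a vertex outside the first one.
overlap⇒meets : (N : Site G t W) → Site G t W′ → W′ ≢ W → z ∈ W → z ∈ W′ →
                Σ ℤ λ v → v ∈ T N × v ∈ W′
overlap⇒meets N N′ W′≢W z∈W z∈W′ with escape N′ N W′≢W
... | a , a∈W′ , a∉W with leave (walk N′ z∈W′ a∈W′) z∈W a∉W
...   | w , w∈W′ , _ , crossing = w , boundary N crossing , w∈W′

total-edge-at : TotalEdge G W x y → x ∈ W ⊎ y ∈ W
total-edge-at (inj₁ (x∈W , _)) = inj₁ x∈W
total-edge-at (inj₂ (inj₁ (x∈W , _))) = inj₁ x∈W
total-edge-at (inj₂ (inj₂ (y∈W , _))) = inj₂ y∈W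

total-edge-within : (N : Site G t W) → TotalEdge G W x y →
                    (x ∈ W ⊎ x ∈ T N) × (y ∈ W ⊎ y ∈ T N)
total-edge-within N (inj₁ (x∈W , y∈W , _)) = inj₁ x∈W , inj₁ y∈W
total-edge-within N (inj₂ (inj₁ crossing@(x∈W , _))) = inj₁ x∈W , inj₂ (boundary N crossing)
total-edge-within N (inj₂ (inj₂ crossing@(y∈W , _))) = inj₂ (boundary N crossing) , inj₁ y∈W

shared-vertex : (N : Site G t W) → ShareEdge G W W′ →
                Σ ℤ λ z → z ∈ W′ × (z ∈ W ⊎ z ∈ T N)
shared-vertex {G = G} {W′ = W′} N (x , y , e , e′)
  with total-edge-at {G = G} {W = W′} e′ | total-edge-within N e
... | inj₁ x∈W′ | x∈W∪T , _ = x , x∈W′ , x∈W∪T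
... | inj₂ y∈W′ | _ , y∈W∪T = y , y∈W′ , y∈W∪T

share⇒meets : (N : Site G t W) → Site G t W′ → W′ ≢ W → ShareEdge G W W′ →
              Σ ℤ λ v → v ∈ T N × v ∈ W′
share⇒meets N N′ W′≢W share with shared-vertex N share
... | z , z∈W′ , inj₁ z∈W = overlap⇒meets N N′ W′≢W z∈W z∈W′
... | z , z∈W′ , inj₂ z∈T = z , z∈T , z∈W′

-- A distinct site W′ containing a vertex v of T has its triangle inside
-- W ++ T: the neighbour of v in W lies in W′ or in T′, so T′ meets W, and the
-- other vertices of T′ are neighbours of that vertex.
meets⇒within : (N : Site G t W) (N′ : Site G t W′) → W′ ≢ W → v ∈ T N → v ∈ W′ →
               T N′ ⊆ W ++ T N
meets⇒within {G = G} {W = W} {W′ = W′} N N′ W′≢W v∈T v∈W′ {y} y∈T′ with anchor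
  where
  anchor : Σ ℤ λ w → w ∈ T N′ × w ∈ W
  anchor with attached N v∈T
  ... | r , r∈W , e with r ∈? W′
  ...   | no r∉W′ = r , boundary N′ (v∈W′ , E-dom G (E-sym G e) , r∉W′ , e) , r∈W
  ...   | yes r∈W′ = overlap⇒meets N′ N (≢-sym W′≢W) r∈W′ r∈W
... | w , w∈T′ , w∈W with w ≟ y
...   | yes refl = ∈-++⁺ˡ w∈W
...   | no w≢y = [ ∈-++⁺ˡ , ∈-++⁺ʳ W ] (neighbour N w∈W (T-clique N′ w∈T′ y∈T′ w≢y))

-- Two sites meeting T coincide when the triangle of the first contains that
-- of the second.  Otherwise v₁ ∈ W₂ (else v₁ would be an outer neighbour of
-- v₂ ∈ W₂, hence in T₂ ⊆ T₁), and walking in W₁ out of W₂ reaches T₂ ∩ W₁.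
triangle-determines : ∀ {v₁ v₂} (N : Site G t W) (N₁ : Site G t W₁) (N₂ : Site G t W₂) →
  v₁ ∈ T N → v₁ ∈ W₁ → v₂ ∈ T N → v₂ ∈ W₂ → T N₂ ⊆ T N₁ → W₁ ≡ W₂
triangle-determines {W₁ = W₁} {W₂ = W₂} {v₁ = v₁} N N₁ N₂ v₁∈T v₁∈W₁ v₂∈T v₂∈W₂ T₂⊆T₁
  with ≡-dec _≟_ W₁ W₂
... | yes W₁≡W₂ = W₁≡W₂
... | no W₁≢W₂ with overlap⇒meets N₂ N₁ W₁≢W₂ v₁∈W₂ v₁∈W₁
  where
  v₁∈W₂ : v₁ ∈ W₂
  v₁∈W₂ with v₁ ∈? W₂
  ... | yes v₁∈W₂ = v₁∈W₂
  ... | no v₁∉W₂ = contradiction v₁∈W₁ (T-outside N₁ (T₂⊆T₁ (boundary N₂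
          (v₂∈W₂ , T-vertex N v₁∈T , v₁∉W₂ ,
           T-clique N v₂∈T v₁∈T λ { refl → v₁∉W₂ v₂∈W₂ }))))
...   | w , w∈T₂ , w∈W₁ = contradiction w∈W₁ (T-outside N₁ (T₂⊆T₁ w∈T₂))

ones : List Bool → ℕ
ones [] = 0
ones (true ∷ bs) = suc (ones bs)
ones (false ∷ bs) = ones bs

Shape : ℕ → ℕ → List Bool → Set
Shape n k m = length m ≡ n × ones m ≡ k

tails : Bool → List (List Bool) → List (List Bool)
tails b [] = []
tails b ([] ∷ ms) = tails b ms
tails b ((c ∷ m) ∷ ms) with c Bool.≟ b
... | yes _ = m ∷ tails b ms
... | no _ = tails b ms

tails-split : ∀ {n k} ms → All (Shape (suc n) k) ms →
              length ms ≡ length (tails true ms) + length (tails false ms)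
tails-split [] [] = refl
tails-split ((true ∷ m) ∷ ms) (_ ∷ shapes) = cong suc (tails-split ms shapes)
tails-split ((false ∷ m) ∷ ms) (_ ∷ shapes) =
  trans (cong suc (tails-split ms shapes)) (sym (+-suc _ _))

tails-true-shape : ∀ {n k} ms → All (Shape (suc n) (suc k)) ms → All (Shape n k) (tails true ms)
tails-true-shape [] [] = []
tails-true-shape ((true ∷ m) ∷ ms) ((refl , refl) ∷ shapes) = (refl , refl) ∷ tails-true-shape ms shapes
tails-true-shape ((false ∷ m) ∷ ms) (_ ∷ shapes) = tails-true-shape ms shapes

tails-false-shape : ∀ {n k} ms → All (Shape (suc n) k) ms → All (Shape n k) (tails false ms)
tails-false-shape [] [] = []
tails-false-shape ((true ∷ m) ∷ ms) (_ ∷ shapes) = tails-false-shape ms shapes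
tails-false-shape ((false ∷ m) ∷ ms) ((refl , refl) ∷ shapes) = (refl , refl) ∷ tails-false-shape ms shapes

tails-true-none : ∀ {n} ms → All (Shape n 0) ms → tails true ms ≡ []
tails-true-none [] [] = refl
tails-true-none ([] ∷ ms) (_ ∷ shapes) = tails-true-none ms shapes
tails-true-none ((false ∷ m) ∷ ms) (_ ∷ shapes) = tails-true-none ms shapes

tails-avoid : ∀ {b m} ms → All ((b ∷ m) ≢_) ms → All (m ≢_) (tails b ms)
tails-avoid [] [] = []
tails-avoid ([] ∷ ms) (_ ∷ ≢ms) = tails-avoid ms ≢ms
tails-avoid {b} ((c ∷ m′) ∷ ms) (≢m′ ∷ ≢ms) with c Bool.≟ b
... | yes refl = (λ m≡m′ → ≢m′ (cong (b ∷_) m≡m′)) ∷ tails-avoid ms ≢ms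
... | no _ = tails-avoid ms ≢ms

tails-distinct : ∀ {b} ms → AllPairs _≢_ ms → AllPairs _≢_ (tails b ms)
tails-distinct [] [] = []
tails-distinct ([] ∷ ms) (_ ∷ distinct) = tails-distinct ms distinct
tails-distinct {b} ((c ∷ m) ∷ ms) (≢m ∷ distinct) with c Bool.≟ b
... | yes refl = tails-avoid ms ≢m ∷ tails-distinct ms distinct
... | no _ = tails-distinct ms distinct

-- There are at most n C k pairwise distinct masks of length n with k ones
-- (Pascal's rule, splitting on the first entry).
masks-bound : ∀ n k ms → AllPairs _≢_ ms → All (Shape n k) ms → length ms ≤ n C k
masks-bound zero k [] _ _ = z≤n
masks-bound zero k ([] ∷ []) _ ((_ , refl) ∷ []) = ≤-refl
masks-bound zero k ([] ∷ [] ∷ _) ((≢[] ∷ _) ∷ _) _ = contradiction refl ≢[]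
masks-bound zero k ([] ∷ (_ ∷ _) ∷ _) _ (_ ∷ (() , _) ∷ _)
masks-bound zero k ((_ ∷ _) ∷ _) _ ((() , _) ∷ _)
masks-bound (suc n) zero ms distinct shapes = begin
  length ms                                        ≡⟨ tails-split ms shapes ⟩
  length (tails true ms) + length (tails false ms) ≡⟨ cong (λ l → length l + length (tails false ms))
                                                         (tails-true-none ms shapes) ⟩
  length (tails false ms)                          ≤⟨ masks-bound n zero (tails false ms)
                                                         (tails-distinct ms distinct) (tails-false-shape ms shapes) ⟩
  n C zero                                         ∎
  where open ≤-Reasoning
masks-bound (suc n) (suc k) ms distinct shapes = begin
  length ms                                        ≡⟨ tails-split ms shapes ⟩
  length (tails true ms) + length (tails false ms) ≤⟨ +-mono-≤
    (masks-bound n k (tails true ms) (tails-distinct ms distinct) (tails-true-shape ms shapes))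
    (masks-bound n (suc k) (tails false ms) (tails-distinct ms distinct) (tails-false-shape ms shapes)) ⟩
  n C k + n C suc k                                ≡⟨ nCk+nC[k+1]≡[n+1]C[k+1] n k ⟩
  suc n C suc k                                    ∎
  where open ≤-Reasoning

mask : List ℤ → List ℤ → List Bool
mask S L = map (λ y → does (y ∈? S)) L

mask-≡⇒⊆ : ∀ {S S′ L} → mask S L ≡ mask S′ L → S ⊆ L → S ⊆ S′
mask-≡⇒⊆ {S} {S′} same S⊆L {y} y∈S with y ∈? S′ | marked-alike (S⊆L y∈S) same
  where
  marked-alike : ∀ {L} → y ∈ L → mask S L ≡ mask S′ L → does (y ∈? S) ≡ does (y ∈? S′)
  marked-alike (here refl) same = ∷-injectiveˡ same
  marked-alike (there y∈L) same = marked-alike y∈L (∷-injectiveʳ same)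
... | yes y∈S′ | _ = y∈S′
... | no _ | alike with () ← trans (sym (dec-true (y ∈? S) y∈S)) alike

ones-mask-disjoint : ∀ {S} L → (∀ {y} → y ∈ L → y ∉ S) → ones (mask S L) ≡ 0
ones-mask-disjoint [] _ = refl
ones-mask-disjoint {S} (y ∷ L) disjoint with y ∈? S
... | yes y∈S = contradiction y∈S (disjoint (here refl))
... | no _ = ones-mask-disjoint L (λ y∈L → disjoint (there y∈L))

ones-mask-singleton : ∀ {s} L → AllPairs _≢_ L → s ∈ L → ones (mask (s ∷ []) L) ≡ 1
ones-mask-singleton {s} (s ∷ L) (s∉L ∷ _) (here refl) with s ≟ s
... | yes _ = cong suc (ones-mask-disjoint {S = s ∷ []} L λ { y∈L (here refl) → lookup s∉L y∈L refl })
... | no s≢s = contradiction refl s≢s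
ones-mask-singleton {s} (y ∷ L) (y∉L ∷ distinct) (there s∈L) with y ≟ s
... | yes refl = contradiction refl (lookup y∉L s∈L)
... | no _ = ones-mask-singleton L distinct s∈L

ones-mask-∷ : ∀ {s S} → s ∉ S → ∀ L →
              ones (mask (s ∷ S) L) ≡ ones (mask (s ∷ []) L) + ones (mask S L)
ones-mask-∷ s∉S [] = refl
ones-mask-∷ {s} {S} s∉S (y ∷ L) with y ≟ s | y ∈? S
... | yes refl | yes y∈S = contradiction y∈S s∉S
... | yes refl | no _ = cong suc (ones-mask-∷ s∉S L)
... | no _ | yes _ = trans (cong suc (ones-mask-∷ s∉S L)) (sym (+-suc _ _))
... | no _ | no _ = ones-mask-∷ s∉S L

ones-mask : ∀ {S L} → AllPairs _≢_ L → AllPairs _≢_ S → S ⊆ L → ones (mask S L) ≡ length S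
ones-mask {[]} {L} _ _ _ = ones-mask-disjoint {S = []} L λ _ ()
ones-mask {s ∷ S} {L} L-distinct (s∉S ∷ S-distinct) sS⊆L = begin
  ones (mask (s ∷ S) L)                        ≡⟨ ones-mask-∷ (λ s∈S → lookup s∉S s∈S refl) L ⟩
  ones (mask (s ∷ []) L) + ones (mask S L)     ≡⟨ cong₂ _+_ (ones-mask-singleton L L-distinct (sS⊆L (here refl)))
                                                      (ones-mask L-distinct S-distinct (λ x∈S → sS⊆L (there x∈S))) ⟩
  suc (length S)                               ∎
  where open ≡-Reasoning

injective-labelling-bound : ∀ {a b p q} {A : Set a} {B : Set b} {P : A → Set p} {Q : B → Set q}
  (label : ∀ {x} → P x → B) →
  (∀ {x y} (px : P x) (py : P y) → label px ≡ label py → x ≡ y) →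
  (∀ {x} (px : P x) → Q (label px)) →
  ∀ {m} → (∀ bs → AllPairs _≢_ bs → All Q bs → length bs ≤ m) →
  ∀ {xs} → AllPairs _≢_ xs → All P xs → length xs ≤ m
injective-labelling-bound {A = A} {P = P} {Q = Q} label injective labelled bound distinct pxs =
  subst (_≤ _) (labels-length pxs) (bound (reduce label pxs) (labels-distinct distinct pxs) (labels-Q pxs))
  where
  labels-length : ∀ {xs} (pxs : All P xs) → length (reduce label pxs) ≡ length xs
  labels-length [] = refl
  labels-length (_ ∷ pxs) = cong suc (labels-length pxs)

  labels-Q : ∀ {xs} (pxs : All P xs) → All Q (reduce label pxs)
  labels-Q [] = []
  labels-Q (px ∷ pxs) = labelled px ∷ labels-Q pxs

  labels-avoid : ∀ {x xs} (px : P x) (pxs : All P xs) →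
                 All (x ≢_) xs → All (label px ≢_) (reduce label pxs)
  labels-avoid px [] [] = []
  labels-avoid px (py ∷ pxs) (x≢y ∷ ≢xs) =
    (λ same → x≢y (injective px py same)) ∷ labels-avoid px pxs ≢xs

  labels-distinct : ∀ {xs : List A} → AllPairs _≢_ xs → (pxs : All P xs) →
                    AllPairs _≢_ (reduce label pxs)
  labels-distinct [] [] = []
  labels-distinct (≢xs ∷ distinct) (px ∷ pxs) = labels-avoid px pxs ≢xs ∷ labels-distinct distinct pxs

Rival : Graph → ℕ → List ℤ → List ℤ → Set₁
Rival G t W W′ = W′ ≢ W × AppearanceOfOrder t G W′ × ShareEdge G W W′

module Rivals {G : Graph} {t : ℕ} {W : List ℤ} (N : Site G t W) where

  -- W together with its triangle: t + 3 distinct vertices.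
  closure : List ℤ
  closure = W ++ T N

  closure-distinct : AllPairs _≢_ closure
  closure-distinct = ++⁺ (AllPairs.map <⇒≢ (Linked⇒AllPairs <-trans (increasing N))) (T-distinct N)
    (tabulate λ y∈W → tabulate λ y′∈T y≡y′ → T-outside N y′∈T (subst (_∈ W) y≡y′ y∈W))

  rival-site : Rival G t W W′ → Site G t W′
  rival-site (_ , app , _) = site {G = G} app

  rival-meets : Rival G t W W′ → Σ ℤ λ v → v ∈ T N × v ∈ W′
  rival-meets r@(W′≢W , _ , share) = share⇒meets N (rival-site r) W′≢W share

  rival-within : (r : Rival G t W W′) → T (rival-site r) ⊆ closure
  rival-within r@(W′≢W , _ , _) with rival-meets r
  ... | v , v∈T , v∈W′ = meets⇒within N (rival-site r) W′≢W v∈T v∈W′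

  label : Rival G t W W′ → List Bool
  label r = mask (T (rival-site r)) closure

  label-shape : (r : Rival G t W W′) → Shape (t + 3) 3 (label r)
  label-shape r =
    trans (length-map _ closure) (trans (length-++ W) (cong₂ _+_ (order N) (T-size N))) ,
    trans (ones-mask closure-distinct (T-distinct (rival-site r)) (rival-within r)) (T-size (rival-site r))

  -- Rivals with the same label have the same triangle, hence coincide.
  label-injective : (r₁ : Rival G t W W₁) (r₂ : Rival G t W W₂) → label r₁ ≡ label r₂ → W₁ ≡ W₂
  label-injective r₁ r₂ same with rival-meets r₁ | rival-meets r₂
  ... | v₁ , v₁∈T , v₁∈W₁ | v₂ , v₂∈T , v₂∈W₂ =
    triangle-determines N (rival-site r₁) (rival-site r₂) v₁∈T v₁∈W₁ v₂∈T v₂∈W₂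
      (mask-≡⇒⊆ (sym same) (rival-within r₂))

lemma8p4 : (G : Graph) (t : ℕ) → 1 ≤ t →
    (W : List ℤ) → AppearanceOfOrder t G W →
    (Ws : List (List ℤ)) → AllPairs _≢_ Ws →
    All (λ W' → W' ≢ W × AppearanceOfOrder t G W' × ShareEdge G W W') Ws →
    length Ws ≤ (t + 3) C 3
lemma8p4 G t _ W app Ws distinct rivals =
  injective-labelling-bound label label-injective label-shape (masks-bound (t + 3) 3) distinct rivals
  where open Rivals (site {G = G} app)
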